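{- In intensional Martin-Löf type theory with weak propositional truncation, for any type $X:\mathcal U$, $X$ has a constant endomap, i.e. $\sum_{f:X\to X}\prod_{x,y:X}f(x)=f(y)$ is inhabited, if and only if $X$ has split support, i.e. there is a map $\lVert X\rVert\to X$.
   Context: Intensional Martin-Löf type theory with a universe $\mathcal U$, $\Sigma$, $\Pi$, $+$ and identity types (J only; no UIP/K). $\mathrm{isProp}(A):\equiv\prod_{a,b:A}a=b$. Weak propositional truncation: for every $A:\mathcal U$ a type $\lVert A\rVert:\mathcal U$ with $|{ - }|:A\to\lVert A\rVert$, a proof of $\mathrm{isProp}(\lVert A\rVert)$, and $\mathrm{rec}:\prod_{P:\mathcal U}\mathrm{isProp}(P)\to(A\to P)\to\lVert A\rVert\to P$ (no judgmental computation rule). "If and only if" means there are functions in both directions between the two types. -}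

{-# OPTIONS --without-K #-}
module Defs where

open import Relation.Binary.PropositionalEquality using (_≡_)
open import Data.Product using (Σ; _×_; _,_)

isProp : Set → Set
isProp A = (a b : A) → a ≡ b

-- Weak propositional truncation on the universe 𝒰 = Set, as assumed structure:
-- a type former, a unit, a proof of propositionality, and a recursor
-- (no judgmental computation rule).
record WeakTruncation : Set₁ where
  field
    ∥_∥      : Set → Set
    ∣_∣      : {A : Set} → A → ∥ A ∥
    ∥∥-isProp : {A : Set} → isProp ∥ A ∥
    rec      : {A : Set} (P : Set) → isProp P → (A → P) → ∥ A ∥ → P

ConstEndo : Set → Set
ConstEndo X = Σ (X → X) (λ f → (x y : X) → f x ≡ f y)

SplitSupport : WeakTruncation → Set → Set
SplitSupport T X = WeakTruncation.∥_∥ T X → X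

_↔'_ : Set → Set → Set
A ↔' B = (A → B) × (B → A)

{-# OPTIONS --without-K #-}
module Submission where

-- Forward direction: the fixed points of a weakly constant endomap f form a
-- proposition, since any two of them are identified along f's constancy path
-- and every path is sent by f to that same path.  As f x is a fixed point for
-- every x, the recursor maps ∥ X ∥ into the fixed points.

open import Defs
open import Data.Product using (Σ; _,_; proj₁)
open import Data.Product.Properties using (Σ-≡,≡→≡)
open import Function using (_∘′_)
open import Relation.Binary.PropositionalEquality

WeaklyConstant : {X Y : Set} → (X → Y) → Set
WeaklyConstant {X} f = (x y : X) → f x ≡ f y

Fix : {X : Set} → (X → X) → Set
Fix {X} f = Σ X (λ x → f x ≡ x)

subst-pointwise-≡ : {X Y : Set} (g h : X → Y) {x y : X} (a : x ≡ y) (p : g x ≡ h x) →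
                    subst (λ z → g z ≡ h z) a p ≡ trans (sym (cong g a)) (trans p (cong h a))
subst-pointwise-≡ g h refl p = sym (trans-reflʳ p)

trans-sym-cancel : {A : Set} {u v w z : A} (e : u ≡ w) (p : u ≡ v) (q : w ≡ z) →
                   trans (sym e) (trans p (trans (sym p) (trans e q))) ≡ q
trans-sym-cancel refl refl q = refl

module WeaklyConstantMap {X Y : Set} (f : X → Y) (c : WeaklyConstant f) where

  -- c corrected so that it is refl on the diagonal, which J needs below.
  c̄ : WeaklyConstant f
  c̄ x y = trans (sym (c x x)) (c x y)

  cong≡c̄ : {x y : X} (a : x ≡ y) → cong f a ≡ c̄ x y
  cong≡c̄ {x} refl = sym (trans-symˡ (c x x))

open WeaklyConstantMap using (c̄; cong≡c̄)

Fix-isProp : {X : Set} (f : X → X) → WeaklyConstant f → isProp (Fix f)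
Fix-isProp f c (x , p) (y , q) = Σ-≡,≡→≡ (a , subst-a-p≡q)
  where
    a : x ≡ y
    a = trans (sym p) (trans (c̄ f c x y) q)

    subst-a-p≡q : subst (λ z → f z ≡ z) a p ≡ q
    subst-a-p≡q = begin
        subst (λ z → f z ≡ z) a p
      ≡⟨ subst-pointwise-≡ f (λ z → z) a p ⟩
        trans (sym (cong f a)) (trans p (cong (λ z → z) a))
      ≡⟨ cong₂ (λ e a′ → trans (sym e) (trans p a′)) (cong≡c̄ f c a) (cong-id a) ⟩
        trans (sym (c̄ f c x y)) (trans p a)
      ≡⟨ trans-sym-cancel (c̄ f c x y) p q ⟩
        q
      ∎
      where open ≡-Reasoning

constEndo⇒splitSupport : (T : WeakTruncation) {X : Set} → ConstEndo X → SplitSupport T X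
constEndo⇒splitSupport T (f , c) =
  proj₁ ∘′ rec (Fix f) (Fix-isProp f c) (λ x → f x , c (f x) x)
  where open WeakTruncation T

splitSupport⇒constEndo : (T : WeakTruncation) {X : Set} → SplitSupport T X → ConstEndo X
splitSupport⇒constEndo T s = (λ x → s ∣ x ∣) , (λ x y → cong s (∥∥-isProp ∣ x ∣ ∣ y ∣))
  where open WeakTruncation T

theorem4p5 : (T : WeakTruncation) (X : Set) → ConstEndo X ↔' SplitSupport T X
theorem4p5 T X = constEndo⇒splitSupport T , splitSupport⇒constEndo T
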